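{- Let $G$ be a context-free grammar with ownership, $A$ a nondeterministic finite automaton over its terminals and $\sigma$ the least solution of the induced system of equations. Let $W_\square=\{\alpha\in(N\cup T)^*:\sigma(\alpha)\text{ is not rejecting}\}$ and $W_\bigcirc=\{\alpha\in(N\cup T)^*:\sigma(\alpha)\text{ is rejecting}\}$. Then $(N\cup T)^*=W_\square\,\dot\cup\,W_\bigcirc$, where $W_\square$ is the winning region of prover in the inclusion game and $W_\bigcirc$ is the winning region of refuter in the non-inclusion game. In particular, inclusion games are determined.
   Context: Game: $G=(N_{\bigcirc}\,\dot\cup\,N_{\square},T,P)$ with disjoint finite sets of non-terminals $N=N_\bigcirc\cup N_\square$ and terminals $T$, finitely many rules $X\to\eta$ ($X\in N$, $\eta\in(N\cup T)^*$), every non-terminal having a rule. $N_\bigcirc$ is owned by refuter, $N_\square$ by prover. Left derivation: $wX\gamma\Rightarrow_L w\eta\gamma$ for $w\in T^*$, $X\in N$ and a rule $X\to\eta$. A sentential form is owned by prover if its leftmost non-terminal is in $N_\square$, else by refuter. Plays are finite or infinite $\Rightarrow_L$-paths; maximal if infinite or ending in a terminal word. $A=(T,Q,q_0,Q_F,\to)$ with language $L(A)$. A maximal play satisfies the inclusion condition (prover's goal) if it is infinite or ends in a word of $L(A)$, and the non-inclusion condition (refuter's goal) if it is finite and ends in a word of $T^*\setminus L(A)$. Strategies for a player map non-maximal finite plays ending in a position of that player to a successor; a strategy is winning from $p_0$ if every maximal play from $p_0$ conforming to it satisfies the player's condition; the winning region is the set of positions with a winning strategy. Domain: Boxes are subsets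 of $Q\times Q$ with relational composition $\rho;\tau=\{(q,q''):\exists q'.(q,q')\in\rho,(q',q'')\in\tau\}$, $\mathrm{id}=\{(q,q)\}$, $[a]=\{(q,q'):q\xrightarrow{a}q'\}$. Formulas are negation-free Boolean formulas over boxes with constant $\mathit{false}$ (with $\mathit{false}\wedge F=\mathit{false}$, $\mathit{false}\vee F=F$, symmetric, applied syntactically), composed by $F;\mathit{false}=\mathit{false};G=\mathit{false}$, $(F_1\star F_2);G=(F_1;G)\star(F_2;G)$, $\rho;(G_1\star G_2)=(\rho;G_1)\star(\rho;G_2)$, $\star\in\{\wedge,\vee\}$, $\rho$ a box; taken modulo logical equivalence, ordered by implication. The induced system has for each $X$ with rules $X\to\eta_1,\dots,X\to\eta_k$ the equation $\Delta_X=\bigwedge_j[\eta_j]$ if $X\in N_\square$ and $\Delta_X=\bigvee_j[\eta_j]$ if $X\in N_\bigcirc$, with $[\varepsilon]=\mathrm{id}$, $[a]$ the box of $a$, $[Y]=\Delta_Y$, $[\alpha\beta]=[\alpha];[\beta]$. $\sigma$ is the least solution (Kleene iteration from $\mathit{false}$), extended by $\sigma(\varepsilon)=\mathrm{id}$, $\sigma(a)=[a]$, $\sigma(\alpha\beta)=\sigma(\alpha);\sigma(\beta)$. A formula is rejecting if it is true under the assignment $\nu$ that maps a box $\rho$ to true iff $\rho$ contains no pair $(q_0,q_f)$ with $q_f\in Q_F$. -}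

module Defs where

open import Data.Nat using (ℕ; zero; suc)
open import Data.Fin using (Fin)
open import Data.Bool using (Bool; true; false; _∧_; _∨_; not)
open import Data.List using (List; []; _∷_; _++_; map; allFin)
open import Data.Bool.ListAction using (or)
open import Data.Vec using (Vec; lookup; tabulate)
open import Data.Sum using (_⊎_; inj₁; inj₂)
open import Data.Product using (Σ; ∃; _×_; _,_; proj₁)
open import Data.Maybe using (Maybe; just; nothing)
open import Data.List.Membership.Propositional using (_∈_)
open import Relation.Binary.PropositionalEquality using (_≡_; _≢_)
open import Relation.Nullary using (¬_)

data Player : Set where
  prover refuter : Player

record Grammar (n t : ℕ) : Set where
  field
    owner   : Fin n → Player
    rules   : Fin n → List (List (Fin n ⊎ Fin t))
    hasRule : ∀ X → rules X ≢ []

record NFA (k t : ℕ) : Set where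
  field
    init  : Fin k
    final : Fin k → Bool
    trans : Fin k → Fin t → Fin k → Bool

module _ {k t : ℕ} (A : NFA k t) where
  open NFA A

  data Run : Fin k → List (Fin t) → Fin k → Set where
    done : ∀ {q} → Run q [] q
    step : ∀ {q q' q'' a w} → trans q a q' ≡ true → Run q' w q'' → Run q (a ∷ w) q''

  Accepts : List (Fin t) → Set
  Accepts w = ∃ λ qf → final qf ≡ true × Run init w qf

-- Boxes: subsets of Q × Q, as Boolean matrices (row q = successors of q)

Box : ℕ → Set
Box k = Vec (Vec Bool k) k

_∈B_ : ∀ {k} → Fin k × Fin k → Box k → Bool
(q , q') ∈B ρ = lookup (lookup ρ q) q'

idBox : ∀ {k} → Box k
idBox {k} = tabulate λ q → tabulate λ q' → isEq q q'
  where
  open import Data.Fin using (_≟_)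
  open import Relation.Nullary using (does)
  isEq : Fin k → Fin k → Bool
  isEq q q' = does (q ≟ q')

_⨾B_ : ∀ {k} → Box k → Box k → Box k
_⨾B_ {k} ρ τ = tabulate λ q → tabulate λ q'' →
  or (map (λ q' → ((q , q') ∈B ρ) ∧ ((q' , q'') ∈B τ)) (allFin k))

letterBox : ∀ {k t} → NFA k t → Fin t → Box k
letterBox A a = tabulate λ q → tabulate λ q' → NFA.trans A q a q'

data Formula (k : ℕ) : Set where
  ff    : Formula k
  atom  : Box k → Formula k
  _∧F_  : Formula k → Formula k → Formula k
  _∨F_  : Formula k → Formula k → Formula k

_⨾_ : ∀ {k} → Formula k → Formula k → Formula k
ff ⨾ G = ff
(F₁ ∧F F₂) ⨾ G = (F₁ ⨾ G) ∧F (F₂ ⨾ G)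
(F₁ ∨F F₂) ⨾ G = (F₁ ⨾ G) ∨F (F₂ ⨾ G)
atom ρ ⨾ ff = ff
atom ρ ⨾ atom τ = atom (ρ ⨾B τ)
atom ρ ⨾ (G₁ ∧F G₂) = (atom ρ ⨾ G₁) ∧F (atom ρ ⨾ G₂)
atom ρ ⨾ (G₁ ∨F G₂) = (atom ρ ⨾ G₁) ∨F (atom ρ ⨾ G₂)

eval : ∀ {k} → (Box k → Bool) → Formula k → Bool
eval v ff = false
eval v (atom ρ) = v ρ
eval v (F ∧F G) = eval v F ∧ eval v G
eval v (F ∨F G) = eval v F ∨ eval v G

_⇒F_ : ∀ {k} → Formula k → Formula k → Set
F ⇒F G = ∀ v → eval v F ≡ true → eval v G ≡ true

_⇔F_ : ∀ {k} → Formula k → Formula k → Set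
F ⇔F G = (F ⇒F G) × (G ⇒F F)

-- finite conjunction / disjunction (only used on non-empty lists)
⋀ : ∀ {k} → List (Formula k) → Formula k
⋀ [] = ff
⋀ (F ∷ []) = F
⋀ (F ∷ Fs@(_ ∷ _)) = F ∧F ⋀ Fs

⋁ : ∀ {k} → List (Formula k) → Formula k
⋁ [] = ff
⋁ (F ∷ []) = F
⋁ (F ∷ Fs@(_ ∷ _)) = F ∨F ⋁ Fs

module _ {n t k : ℕ} (G : Grammar n t) (A : NFA k t) where
  open Grammar G

  Sym : Set
  Sym = Fin n ⊎ Fin t

  semSym : (Fin n → Formula k) → Sym → Formula k
  semSym σ (inj₁ Y) = σ Y
  semSym σ (inj₂ a) = atom (letterBox A a)

  sem : (Fin n → Formula k) → List Sym → Formula k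
  sem σ [] = atom idBox
  sem σ (x ∷ α) = semSym σ x ⨾ sem σ α

  rhs : (Fin n → Formula k) → Fin n → Formula k
  rhs σ X with owner X
  ... | prover  = ⋀ (map (sem σ) (rules X))
  ... | refuter = ⋁ (map (sem σ) (rules X))

  IsSolution : (Fin n → Formula k) → Set
  IsSolution σ = ∀ X → σ X ⇔F rhs σ X

  -- least solution w.r.t. the implication order (formulas modulo equivalence)
  IsLeastSolution : (Fin n → Formula k) → Set
  IsLeastSolution σ = IsSolution σ × (∀ τ → IsSolution τ → ∀ X → σ X ⇒F τ X)

ν : ∀ {k t} → NFA k t → Box k → Bool
ν {k} A ρ = not (or (map (λ qf → ((NFA.init A , qf) ∈B ρ) ∧ NFA.final A qf) (allFin k)))

Rejecting : ∀ {k t} → NFA k t → Formula k → Set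
Rejecting A F = eval (ν A) F ≡ true

module _ {n t : ℕ} (G : Grammar n t) where
  open Grammar G

  SF : Set
  SF = List (Fin n ⊎ Fin t)

  terminalWord : List (Fin t) → SF
  terminalWord w = map inj₂ w

  leftmost : SF → Maybe (Fin n)
  leftmost [] = nothing
  leftmost (inj₁ X ∷ _) = just X
  leftmost (inj₂ a ∷ α) = leftmost α

  data Step : SF → SF → Set where
    derive : ∀ (w : List (Fin t)) X η γ → η ∈ rules X →
             Step (terminalWord w ++ inj₁ X ∷ γ) (terminalWord w ++ η ++ γ)

  -- A strategy for player p: given the history of the play so far
  -- (earlier positions, most recent first) and the current position α,
  -- which is non-maximal (has a leftmost non-terminal X) and owned by p,
  -- choose a successor.
  Strategy : Player → Set
  Strategy p = (h : List SF) (α : SF) (X : Fin n) →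
               leftmost α ≡ just X → owner X ≡ p → Σ SF (Step α)

  Conforms : ∀ {p} → Strategy p → List SF → SF → SF → Set
  Conforms {p} s h α β =
    ∀ X (e : leftmost α ≡ just X) (o : owner X ≡ p) → β ≡ proj₁ (s h α X e o)

  -- finite plays from p₀ conforming to s: Reach s p₀ h α means that
  -- reverse (α ∷ h) is such a play
  data Reach {p} (s : Strategy p) (p₀ : SF) : List SF → SF → Set where
    start : Reach s p₀ [] p₀
    move  : ∀ {h α β} → Reach s p₀ h α → Step α β → Conforms s h α β →
            Reach s p₀ (α ∷ h) β

  history : (ℕ → SF) → ℕ → List SF
  history π zero = []
  history π (suc i) = π i ∷ history π i

  InfinitePlay : ∀ {p} → Strategy p → SF → Set
  InfinitePlay s p₀ = Σ (ℕ → SF) λ π → π 0 ≡ p₀ ×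
    (∀ i → Step (π i) (π (suc i)) × Conforms s (history π i) (π i) (π (suc i)))

  module _ {k : ℕ} (A : NFA k t) where

    -- s is winning for prover in the inclusion game from p₀: every maximal
    -- conforming play is infinite or ends in a word of L(A); i.e. every
    -- finite maximal conforming play (ending in a terminal word) ends in L(A).
    WinsInclusion : Strategy prover → SF → Set
    WinsInclusion s p₀ = ∀ h w → Reach s p₀ h (terminalWord w) → Accepts A w

    WinsNonInclusion : Strategy refuter → SF → Set
    WinsNonInclusion s p₀ =
      ¬ InfinitePlay s p₀ ×
      (∀ h w → Reach s p₀ h (terminalWord w) → ¬ Accepts A w)

    ProverRegion : SF → Set
    ProverRegion p₀ = Σ (Strategy prover) λ s → WinsInclusion s p₀

    RefuterRegion : SF → Set
    RefuterRegion p₀ = Σ (Strategy refuter) λ s → WinsNonInclusion s p₀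

-- Prover keeps the play among positions whose formula is not rejecting: σ satisfies the
-- equations, so at her non-terminals some rule, and at refuter's every rule, preserves this,
-- and a terminal word with a non-rejecting box is accepted. Refuter argues with the Kleene
-- approximants, one of which is a solution and hence lies above σ. Annotate each non-terminal
-- with the stage at which it is evaluated and weigh a stage-j occurrence as (1 + total rule
-- length)^j: then unfolding a non-terminal strictly lowers the weight, so from a rejecting
-- position refuter can force a rejected terminal word within weight-many moves. A play
-- following winning strategies of both players could never end, while refuter's strategy admits
-- no infinite play; so the two regions are disjoint, and by the above they cover everything.

module Submission where

open import Defs
open import Data.Nat using (ℕ; zero; suc; _+_; _*_; _∸_; _^_; _≤_; _<_; z≤n; s≤s; pred)
open import Data.Nat.Properties
  using (≤-refl; ≤-trans; ≤-<-trans; <-irrefl; +-mono-≤; +-mono-<-≤; +-mono-≤-<; +-monoˡ-<; +-monoʳ-≤;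
         m≤m+n; m≤n+m; m<n+m; *-monoˡ-≤; m^n>0; m<1+n⇒m≤n; n∸n≡0; pred[m∸n]≡m∸[1+n]; module ≤-Reasoning)
open import Data.Nat.ListAction using (sum)
open import Data.Fin using (Fin)
open import Data.Product using (_×_; Σ; ∃; _,_; proj₁; proj₂)
open import Data.Sum using (_⊎_; inj₁; inj₂; map₁)
open import Data.Bool using (Bool; true; false; _∧_; _∨_; not; if_then_else_; _≟_)
open import Data.Bool.Properties using (∧-identityʳ; ∨-identityʳ; ¬-not; not-injective)
open import Data.Bool.ListAction using (and; or; all; any)
open import Data.List.Properties using (map-cong; map-++; map-∘)
open import Data.Nat.ListAction.Properties using (sum-++)
open import Data.List using (List; []; _∷_; _++_; map; allFin; length; cartesianProduct; cartesianProductWith)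
open import Data.List.Membership.Propositional using (_∈_)
open import Data.List.Membership.Propositional.Properties using (∈-allFin; ∈-cartesianProduct⁺; ∈-cartesianProductWith⁺)
open import Data.List.Relation.Unary.Any using (here; there)
open import Data.Empty using (⊥; ⊥-elim)
open import Data.Maybe using (just; nothing)
open import Relation.Nullary using (¬_; yes; no; does; contradiction)
open import Relation.Nullary.Decidable using (dec-true)
open import Relation.Binary.PropositionalEquality
open import Relation.Binary.Definitions using (DecidableEquality)
open import Axiom.UniquenessOfIdentityProofs.WithK using (uip)
open import Function using (_∘_; _⇔_; mk⇔; case_of_)
open import Data.Vec using (Vec; lookup; tabulate)
import Data.Vec as Vec
open import Data.Vec.Properties using (lookup∘tabulate; tabulate∘lookup; tabulate-cong; ≡-dec)
import Data.Fin as Fin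

private variable
  E : Set

∧-elim : ∀ {a b} → a ∧ b ≡ true → a ≡ true × b ≡ true
∧-elim {true} {true} refl = refl , refl

∧-intro : ∀ {a b} → a ≡ true → b ≡ true → a ∧ b ≡ true
∧-intro refl refl = refl

∨-elim : ∀ {a b} → a ∨ b ≡ true → a ≡ true ⊎ b ≡ true
∨-elim {true} _ = inj₁ refl
∨-elim {false} e = inj₂ e

∨-introˡ : ∀ {a b} → a ≡ true → a ∨ b ≡ true
∨-introˡ refl = refl

∨-introʳ : ∀ {a b} → b ≡ true → a ∨ b ≡ true
∨-introʳ {true} _ = refl
∨-introʳ {false} e = e

≡true-ext : ∀ {a b} → (a ≡ true → b ≡ true) → (b ≡ true → a ≡ true) → a ≡ b
≡true-ext {true} f _ = sym (f refl)
≡true-ext {false} {true} _ g = g refl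
≡true-ext {false} {false} _ _ = refl

module _ (f : E → Bool) where

  all-true : ∀ {x xs} → all f xs ≡ true → x ∈ xs → f x ≡ true
  all-true e (here refl) = proj₁ (∧-elim e)
  all-true {xs = y ∷ _} e (there x∈) = all-true (proj₂ (∧-elim {f y} e)) x∈

  all-intro : ∀ xs → (∀ {x} → x ∈ xs → f x ≡ true) → all f xs ≡ true
  all-intro [] _ = refl
  all-intro (x ∷ xs) h = ∧-intro (h (here refl)) (all-intro xs (h ∘ there))

  all-false : ∀ xs → all f xs ≡ false → ∃ λ x → x ∈ xs × f x ≡ false
  all-false (x ∷ xs) e with f x in fx
  ... | false = x , here refl , fx
  ... | true  = let y , y∈ , fy = all-false xs e in y , there y∈ , fy

  any-true : ∀ xs → any f xs ≡ true → ∃ λ x → x ∈ xs × f x ≡ true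
  any-true (x ∷ xs) e with f x in fx
  ... | true  = x , here refl , fx
  ... | false = let y , y∈ , fy = any-true xs e in y , there y∈ , fy

  any-intro : ∀ {x xs} → x ∈ xs → f x ≡ true → any f xs ≡ true
  any-intro (here refl) e = ∨-introˡ e
  any-intro {xs = y ∷ _} (there x∈) e = ∨-introʳ {f y} (any-intro x∈ e)

  any-false : ∀ {x xs} → any f xs ≡ false → x ∈ xs → f x ≡ false
  any-false {xs = y ∷ _} e x∈ with f y in fy
  any-false e (here refl) | false = fy
  any-false e (there x∈)  | false = any-false e x∈

  choose : (xs : List E) → xs ≢ [] → Σ E λ x → x ∈ xs × (any f xs ≡ true → f x ≡ true)
  choose [] ne = ⊥-elim (ne refl)
  choose xs@(x ∷ _) _ with any f xs in e
  ... | true  = let y , y∈ , fy = any-true xs e in y , y∈ , λ _ → fy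
  ... | false = x , here refl , λ ()

quantifier : Player → (E → Bool) → List E → Bool
quantifier prover  = all
quantifier refuter = any

quantifier-cong : ∀ p {f g : E → Bool} xs → f ≗ g → quantifier p f xs ≡ quantifier p g xs
quantifier-cong prover  xs f≗g = cong and (map-cong f≗g xs)
quantifier-cong refuter xs f≗g = cong or (map-cong f≗g xs)

quantifier-mono : ∀ p {f g : E → Bool} xs → (∀ {x} → x ∈ xs → f x ≡ true → g x ≡ true) →
                  quantifier p f xs ≡ true → quantifier p g xs ≡ true
quantifier-mono prover  {f} {g} xs h e = all-intro g xs (λ x∈ → h x∈ (all-true f e x∈))
quantifier-mono refuter {f} {g} xs h e = let x , x∈ , fx = any-true f xs e in any-intro g x∈ (h x∈ fx)

≤-sum-map : ∀ (f : E → ℕ) {x xs} → x ∈ xs → f x ≤ sum (map f xs)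
≤-sum-map f {xs = x ∷ xs} (here refl) = m≤m+n (f x) _
≤-sum-map f {xs = y ∷ xs} (there x∈) = ≤-trans (≤-sum-map f x∈) (m≤n+m _ (f y))

module _ {f g : E → ℕ} (f≤g : ∀ x → f x ≤ g x) where

  sum-map-mono : ∀ xs → sum (map f xs) ≤ sum (map g xs)
  sum-map-mono [] = z≤n
  sum-map-mono (x ∷ xs) = +-mono-≤ (f≤g x) (sum-map-mono xs)

  sum-map-strict : ∀ {x} xs → x ∈ xs → f x < g x → sum (map f xs) < sum (map g xs)
  sum-map-strict (x ∷ xs) (here refl) fx<gx = +-mono-<-≤ fx<gx (sum-map-mono xs)
  sum-map-strict (y ∷ xs) (there x∈) fx<gx = +-mono-≤-< (f≤g y) (sum-map-strict xs x∈ fx<gx)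

module _ (f : ℕ → E → Bool) (ascending : ∀ j {x} → f j x ≡ true → f (suc j) x ≡ true)
         (xs : List E) where

  private
    indicator : Bool → ℕ
    indicator true  = 1
    indicator false = 0

    indicator≤1 : ∀ b → indicator b ≤ 1
    indicator≤1 true  = ≤-refl
    indicator≤1 false = z≤n

    indicator-mono : ∀ {a b} → (a ≡ true → b ≡ true) → indicator a ≤ indicator b
    indicator-mono {false} _ = z≤n
    indicator-mono {true} a⇒b rewrite a⇒b refl = ≤-refl

    size : ℕ → ℕ
    size j = sum (map (indicator ∘ f j) xs)

    stationary? : ℕ → Bool
    stationary? j = all (λ x → not (f (suc j) x) ∨ f j x) xs

    size-grows : ∀ j → stationary? j ≡ false → size j < size (suc j)
    size-grows j e with x , x∈ , grows ← all-false _ xs e =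
      sum-map-strict (λ x → indicator-mono (ascending j)) xs x∈ (strict grows)
      where
      strict : ∀ {a b} → not a ∨ b ≡ false → indicator b < indicator a
      strict {true} {false} _ = s≤s z≤n

    search : ∀ j → (∃ λ m → stationary? m ≡ true) ⊎ j ≤ size j
    search zero = inj₂ z≤n
    search (suc j) with search j
    ... | inj₁ found = inj₁ found
    ... | inj₂ j≤size with stationary? j in e
    ...   | true  = inj₁ (j , e)
    ...   | false = inj₂ (≤-<-trans j≤size (size-grows j e))

  ascending-stationary : ∃ λ m → ∀ {x} → x ∈ xs → f (suc m) x ≡ true → f m x ≡ true
  ascending-stationary with search (suc (length xs))
  ... | inj₁ (m , stationary) = m , λ x∈ → implication (all-true _ stationary x∈)
    where
    implication : ∀ {a b} → not a ∨ b ≡ true → a ≡ true → b ≡ true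
    implication {true} e refl = e
  ... | inj₂ overfull = ⊥-elim (<-irrefl refl (≤-trans overfull (size-bounded xs)))
    where
    size-bounded : ∀ ys → sum (map (indicator ∘ f (suc (length xs))) ys) ≤ length ys
    size-bounded [] = z≤n
    size-bounded (y ∷ ys) = +-mono-≤ (indicator≤1 (f _ y)) (size-bounded ys)

-- Boxes

module _ {k : ℕ} where

  ∈B-tabulate : ∀ (f : Fin k → Fin k → Bool) q q' → (q , q') ∈B tabulate (tabulate ∘ f) ≡ f q q'
  ∈B-tabulate f q q' = trans (cong (λ r → lookup r q') (lookup∘tabulate _ q)) (lookup∘tabulate _ q')

  box-ext : ∀ {ρ τ : Box k} → (∀ q q' → (q , q') ∈B ρ ≡ (q , q') ∈B τ) → ρ ≡ τ
  box-ext {ρ} {τ} h = begin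
    ρ                                                ≡⟨ tabulate∘lookup ρ ⟨
    tabulate (λ q → lookup ρ q)                      ≡⟨ tabulate-cong (λ q → tabulate∘lookup (lookup ρ q)) ⟨
    tabulate (λ q → tabulate (λ q' → (q , q') ∈B ρ)) ≡⟨ tabulate-cong (λ q → tabulate-cong (h q)) ⟩
    tabulate (λ q → tabulate (λ q' → (q , q') ∈B τ)) ≡⟨ tabulate-cong (λ q → tabulate∘lookup (lookup τ q)) ⟩
    tabulate (λ q → lookup τ q)                      ≡⟨ tabulate∘lookup τ ⟩
    τ                                                ∎
    where open ≡-Reasoning

  box-antisym : ∀ {ρ τ : Box k} → (∀ {q q'} → (q , q') ∈B ρ ≡ true → (q , q') ∈B τ ≡ true) →
             (∀ {q q'} → (q , q') ∈B τ ≡ true → (q , q') ∈B ρ ≡ true) → ρ ≡ τ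
  box-antisym f g = box-ext λ q q' → ≡true-ext f g

  idBox-refl : ∀ q → (q , q) ∈B idBox {k} ≡ true
  idBox-refl q = trans (∈B-tabulate _ q q) (dec-true (q Fin.≟ q) refl)

  idBox-elim : ∀ {q q'} → (q , q') ∈B idBox {k} ≡ true → q ≡ q'
  idBox-elim {q} {q'} e with q Fin.≟ q' | ∈B-tabulate (λ q q' → does (q Fin.≟ q')) q q'
  ... | yes q≡q' | _ = q≡q'
  ... | no _     | r with () ← trans (sym e) r

  ⨾B-elim : ∀ (ρ τ : Box k) {q q'} → (q , q') ∈B (ρ ⨾B τ) ≡ true →
            ∃ λ q₁ → (q , q₁) ∈B ρ ≡ true × (q₁ , q') ∈B τ ≡ true
  ⨾B-elim ρ τ {q} {q'} e =
    let q₁ , _ , both = any-true _ (allFin k) (trans (sym (∈B-tabulate _ q q')) e) in q₁ , ∧-elim both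

  ⨾B-intro : ∀ (ρ τ : Box k) {q q₁ q'} → (q , q₁) ∈B ρ ≡ true → (q₁ , q') ∈B τ ≡ true →
             (q , q') ∈B (ρ ⨾B τ) ≡ true
  ⨾B-intro ρ τ {q} {q₁} {q'} a b = trans (∈B-tabulate _ q q') (any-intro _ (∈-allFin q₁) (∧-intro a b))

  ⨾B-assoc : ∀ (ρ τ μ : Box k) → (ρ ⨾B τ) ⨾B μ ≡ ρ ⨾B (τ ⨾B μ)
  ⨾B-assoc ρ τ μ = box-antisym to from
    where
    to : ∀ {q q'} → (q , q') ∈B ((ρ ⨾B τ) ⨾B μ) ≡ true → (q , q') ∈B (ρ ⨾B (τ ⨾B μ)) ≡ true
    to e with _ , ρτ , μ' ← ⨾B-elim (ρ ⨾B τ) μ e with _ , ρ' , τ' ← ⨾B-elim ρ τ ρτ =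
      ⨾B-intro ρ (τ ⨾B μ) ρ' (⨾B-intro τ μ τ' μ')
    from : ∀ {q q'} → (q , q') ∈B (ρ ⨾B (τ ⨾B μ)) ≡ true → (q , q') ∈B ((ρ ⨾B τ) ⨾B μ) ≡ true
    from e with _ , ρ' , τμ ← ⨾B-elim ρ (τ ⨾B μ) e with _ , τ' , μ' ← ⨾B-elim τ μ τμ =
      ⨾B-intro (ρ ⨾B τ) μ (⨾B-intro ρ τ ρ' τ') μ'

  ⨾B-identityˡ : ∀ (τ : Box k) → idBox ⨾B τ ≡ τ
  ⨾B-identityˡ τ = box-antisym to (⨾B-intro idBox τ (idBox-refl _))
    where
    to : ∀ {q q'} → (q , q') ∈B (idBox ⨾B τ) ≡ true → (q , q') ∈B τ ≡ true
    to {q} {q'} e with q₁ , i , τ' ← ⨾B-elim idBox τ e = subst (λ p → (p , q') ∈B τ ≡ true) (sym (idBox-elim i)) τ'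

-- Formulas

module _ {k : ℕ} where

  Valuation : Set
  Valuation = Box k → Bool

  eval-mono : ∀ {u v : Valuation} → (∀ ρ → u ρ ≡ true → v ρ ≡ true) →
              ∀ F → eval u F ≡ true → eval v F ≡ true
  eval-mono h (atom ρ) e = h ρ e
  eval-mono {u} h (F ∧F G) e =
    let eF , eG = ∧-elim {eval u F} e in ∧-intro (eval-mono h F eF) (eval-mono h G eG)
  eval-mono {u} h (F ∨F G) e with ∨-elim {eval u F} e
  ... | inj₁ eF = ∨-introˡ (eval-mono h F eF)
  ... | inj₂ eG = ∨-introʳ (eval-mono h G eG)

  eval-cong : ∀ {u v : Valuation} → u ≗ v → ∀ F → eval u F ≡ eval v F
  eval-cong h ff = refl
  eval-cong h (atom ρ) = h ρ
  eval-cong h (F ∧F G) = cong₂ _∧_ (eval-cong h F) (eval-cong h G)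
  eval-cong h (F ∨F G) = cong₂ _∨_ (eval-cong h F) (eval-cong h G)

  after : Box k → Valuation → Valuation
  after ρ v τ = v (ρ ⨾B τ)

  through : Formula k → Valuation → Valuation
  through G v ρ = eval (after ρ v) G

  eval-atom⨾ : ∀ v ρ G → eval v (atom ρ ⨾ G) ≡ eval (after ρ v) G
  eval-atom⨾ v ρ ff = refl
  eval-atom⨾ v ρ (atom τ) = refl
  eval-atom⨾ v ρ (G ∧F H) = cong₂ _∧_ (eval-atom⨾ v ρ G) (eval-atom⨾ v ρ H)
  eval-atom⨾ v ρ (G ∨F H) = cong₂ _∨_ (eval-atom⨾ v ρ G) (eval-atom⨾ v ρ H)

  eval-⨾ : ∀ v F G → eval v (F ⨾ G) ≡ eval (through G v) F
  eval-⨾ v ff G = refl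
  eval-⨾ v (atom ρ) G = eval-atom⨾ v ρ G
  eval-⨾ v (F ∧F F') G = cong₂ _∧_ (eval-⨾ v F G) (eval-⨾ v F' G)
  eval-⨾ v (F ∨F F') G = cong₂ _∨_ (eval-⨾ v F G) (eval-⨾ v F' G)

  after-idBox : ∀ v → after idBox v ≗ v
  after-idBox v τ = cong v (⨾B-identityˡ τ)

  through-after : ∀ S ρ v → through S (after ρ v) ≗ after ρ (through S v)
  through-after S ρ v τ = eval-cong (λ μ → cong v (sym (⨾B-assoc ρ τ μ))) S

  ⨾-mono : ∀ {F F' G G' : Formula k} → F ⇒F F' → G ⇒F G' → (F ⨾ G) ⇒F (F' ⨾ G')
  ⨾-mono {F} {F'} {G} {G'} F⇒F' G⇒G' v e =
    subst (_≡ true) (sym (eval-⨾ v F' G'))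
      (F⇒F' _ (eval-mono (λ ρ → G⇒G' (after ρ v)) F (subst (_≡ true) (eval-⨾ v F G) e)))

  eval-⋀ : ∀ v (F : E → Formula k) xs → xs ≢ [] → eval v (⋀ (map F xs)) ≡ all (eval v ∘ F) xs
  eval-⋀ v F [] ne = ⊥-elim (ne refl)
  eval-⋀ v F (x ∷ []) _ = sym (∧-identityʳ _)
  eval-⋀ v F (x ∷ xs@(_ ∷ _)) _ = cong (eval v (F x) ∧_) (eval-⋀ v F xs λ ())

  eval-⋁ : ∀ v (F : E → Formula k) xs → eval v (⋁ (map F xs)) ≡ any (eval v ∘ F) xs
  eval-⋁ v F [] = refl
  eval-⋁ v F (x ∷ []) = sym (∨-identityʳ _)
  eval-⋁ v F (x ∷ xs@(_ ∷ _)) = cong (eval v (F x) ∨_) (eval-⋁ v F xs)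

module _ {k t : ℕ} (A : NFA k t) where
  open NFA A using (init; final) renaming (trans to δ)

  wordBox : List (Fin t) → Box k
  wordBox [] = idBox
  wordBox (a ∷ w) = letterBox A a ⨾B wordBox w

  ∈B-letterBox : ∀ a q q' → (q , q') ∈B letterBox A a ≡ δ q a q'
  ∈B-letterBox a = ∈B-tabulate (λ q q' → δ q a q')

  wordBox⇒Run : ∀ w {q q'} → (q , q') ∈B wordBox w ≡ true → Run A q w q'
  wordBox⇒Run [] {q} e with refl ← idBox-elim {k} {q} e = done
  wordBox⇒Run (a ∷ w) e with q₁ , ea , ew ← ⨾B-elim (letterBox A a) (wordBox w) e =
    step (trans (sym (∈B-letterBox a _ q₁)) ea) (wordBox⇒Run w ew)

  Run⇒wordBox : ∀ {q w q'} → Run A q w q' → (q , q') ∈B wordBox w ≡ true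
  Run⇒wordBox {q} done = idBox-refl q
  Run⇒wordBox (step {a = a} {w} tr r) =
    ⨾B-intro (letterBox A a) (wordBox w) (trans (∈B-letterBox a _ _) tr) (Run⇒wordBox r)

  ¬ν⇒Accepts : ∀ w → ν A (wordBox w) ≡ false → Accepts A w
  ¬ν⇒Accepts w e with any-true _ (allFin k) (not-injective e)
  ... | qf , _ , run∧final = let run , fin = ∧-elim run∧final in qf , fin , wordBox⇒Run w run

  ν⇒¬Accepts : ∀ w → ν A (wordBox w) ≡ true → ¬ Accepts A w
  ν⇒¬Accepts w e (qf , fin , run) with () ← trans (sym e)
    (cong not (any-intro (λ q → ((init , q) ∈B wordBox w) ∧ final q) (∈-allFin qf) (∧-intro (Run⇒wordBox run) fin)))

-- Sentential forms

module _ {t : ℕ} {N : Set} where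

  word : List (Fin t) → List (N ⊎ Fin t)
  word = map inj₂

  data View : List (N ⊎ Fin t) → Set where
    terminal    : ∀ w → View (word w)
    nonterminal : ∀ w X γ → View (word w ++ inj₁ X ∷ γ)

  view : ∀ α → View α
  view [] = terminal []
  view (inj₁ X ∷ γ) = nonterminal [] X γ
  view (inj₂ a ∷ α) with view α
  ... | terminal w        = terminal (a ∷ w)
  ... | nonterminal w X γ = nonterminal (a ∷ w) X γ

  view-word : ∀ w → view (word w) ≡ terminal w
  view-word [] = refl
  view-word (a ∷ w) rewrite view-word w = refl

  view-nonterminal : ∀ w X γ → view (word w ++ inj₁ X ∷ γ) ≡ nonterminal w X γ
  view-nonterminal [] X γ = refl
  view-nonterminal (a ∷ w) X γ rewrite view-nonterminal w X γ = refl

module _ {k t : ℕ} (A : NFA k t) {N : Set} where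

  symbol : (N → Formula k) → N ⊎ Fin t → Formula k
  symbol g (inj₁ X) = g X
  symbol g (inj₂ a) = atom (letterBox A a)

  denote : (N → Formula k) → List (N ⊎ Fin t) → Formula k
  denote g [] = atom idBox
  denote g (x ∷ α) = symbol g x ⨾ denote g α

  module _ (g : N → Formula k) where

    denote-word : ∀ w → denote g (word w) ≡ atom (wordBox A w)
    denote-word [] = refl
    denote-word (a ∷ w) = cong (atom (letterBox A a) ⨾_) (denote-word w)

    eval-denote-++ : ∀ v η γ → eval v (denote g (η ++ γ)) ≡ eval (through (denote g γ) v) (denote g η)
    eval-denote-++ v [] γ = sym (eval-cong (after-idBox v) (denote g γ))
    eval-denote-++ v (x ∷ η) γ = begin
      eval v (symbol g x ⨾ denote g (η ++ γ))                    ≡⟨ eval-⨾ v (symbol g x) _ ⟩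
      eval (through (denote g (η ++ γ)) v) (symbol g x)          ≡⟨ eval-cong through-++ (symbol g x) ⟩
      eval (through (denote g η) (through (denote g γ) v)) (symbol g x) ≡⟨ eval-⨾ _ (symbol g x) _ ⟨
      eval (through (denote g γ) v) (symbol g x ⨾ denote g η)    ∎
      where
      open ≡-Reasoning
      through-++ : through (denote g (η ++ γ)) v ≗ through (denote g η) (through (denote g γ) v)
      through-++ ρ = trans (eval-denote-++ (after ρ v) η γ)
                           (eval-cong (through-after (denote g γ) ρ v) (denote g η))

    eval-denote-word++ : ∀ v w ζ → eval v (denote g (word w ++ ζ)) ≡ eval (after (wordBox A w) v) (denote g ζ)
    eval-denote-word++ v w ζ = begin
      eval v (denote g (word w ++ ζ))                         ≡⟨ eval-denote-++ v (word w) ζ ⟩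
      eval (through (denote g ζ) v) (denote g (word w))       ≡⟨ cong (eval _) (denote-word w) ⟩
      eval (after (wordBox A w) v) (denote g ζ)               ∎
      where open ≡-Reasoning

    -- the valuation that the position of X in w X γ induces on the formula of X
    context : List (Fin t) → List (N ⊎ Fin t) → Valuation → Valuation
    context w γ v = through (denote g γ) (after (wordBox A w) v)

    eval-at-nonterminal : ∀ v w X γ → eval v (denote g (word w ++ inj₁ X ∷ γ)) ≡ eval (context w γ v) (g X)
    eval-at-nonterminal v w X γ = trans (eval-denote-word++ v w (inj₁ X ∷ γ)) (eval-⨾ _ (g X) (denote g γ))

    eval-at-replacement : ∀ v w η γ → eval v (denote g (word w ++ η ++ γ)) ≡ eval (context w γ v) (denote g η)
    eval-at-replacement v w η γ = trans (eval-denote-word++ v w (η ++ γ)) (eval-denote-++ _ η γ)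

  denote-mono : ∀ {g g' : N → Formula k} → (∀ X → g X ⇒F g' X) → ∀ α → denote g α ⇒F denote g' α
  denote-mono g⇒g' [] v e = e
  denote-mono {g} {g'} g⇒g' (x ∷ α) =
    ⨾-mono {F = symbol g x} {symbol g' x} {denote g α} {denote g' α} (symbol-mono x) (denote-mono g⇒g' α)
    where
    symbol-mono : ∀ x → symbol g x ⇒F symbol g' x
    symbol-mono (inj₁ X) = g⇒g' X
    symbol-mono (inj₂ a) v e = e

-- Kleene iteration

vectors : List E → (m : ℕ) → List (Vec E m)
vectors xs zero = Vec.[] ∷ []
vectors xs (suc m) = cartesianProductWith Vec._∷_ xs (vectors xs m)

∈-vectors : ∀ {xs : List E} → (∀ x → x ∈ xs) → ∀ {m} (v : Vec E m) → v ∈ vectors xs m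
∈-vectors _ Vec.[] = here refl
∈-vectors ∈xs (x Vec.∷ v) = ∈-cartesianProductWith⁺ Vec._∷_ (∈xs x) (∈-vectors ∈xs v)

bools : List Bool
bools = true ∷ false ∷ []

∈-bools : ∀ b → b ∈ bools
∈-bools true  = here refl
∈-bools false = there (here refl)

module _ {k : ℕ} where

  boxes : List (Box k)
  boxes = vectors (vectors bools k) k

  ∈-boxes : ∀ ρ → ρ ∈ boxes
  ∈-boxes = ∈-vectors (∈-vectors ∈-bools)

  _≟B_ : DecidableEquality (Box k)
  _≟B_ = ≡-dec (≡-dec _≟_)

  override : Box k → Bool → Valuation → Valuation
  override ρ b v τ = if does (τ ≟B ρ) then b else v τ

  valuationsOn : List (Box k) → List Valuation
  valuationsOn [] = (λ _ → false) ∷ []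
  valuationsOn (ρ ∷ ρs) = cartesianProductWith (override ρ) bools (valuationsOn ρs)

  valuationsOn-complete : ∀ (v : Valuation) ρs → ∃ λ u → u ∈ valuationsOn ρs × (∀ {ρ} → ρ ∈ ρs → u ρ ≡ v ρ)
  valuationsOn-complete v [] = _ , here refl , λ ()
  valuationsOn-complete v (ρ ∷ ρs) with u , u∈ , agrees ← valuationsOn-complete v ρs =
    override ρ (v ρ) u , ∈-cartesianProductWith⁺ (override ρ) (∈-bools (v ρ)) u∈ , agrees′
    where
    agrees′ : ∀ {τ} → τ ∈ ρ ∷ ρs → override ρ (v ρ) u τ ≡ v τ
    agrees′ {τ} τ∈ with τ ≟B ρ
    ... | yes refl = refl
    agrees′ (here refl)  | no τ≢ρ = ⊥-elim (τ≢ρ refl)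
    agrees′ (there τ∈ρs) | no _   = agrees τ∈ρs

  valuations : List Valuation
  valuations = valuationsOn boxes

  valuations-complete : ∀ (v : Valuation) → ∃ λ u → u ∈ valuations × u ≗ v
  valuations-complete v with u , u∈ , agrees ← valuationsOn-complete v boxes = u , u∈ , λ ρ → agrees (∈-boxes ρ)

module _ {n t k : ℕ} (G : Grammar n t) (A : NFA k t) where
  open Grammar G

  sem≡denote : ∀ τ α → sem G A τ α ≡ denote A τ α
  sem≡denote τ [] = refl
  sem≡denote τ (inj₁ X ∷ α) = cong (τ X ⨾_) (sem≡denote τ α)
  sem≡denote τ (inj₂ a ∷ α) = cong (atom (letterBox A a) ⨾_) (sem≡denote τ α)

  eval-rhs : ∀ τ u X → eval u (rhs G A τ X) ≡ quantifier (owner X) (λ η → eval u (denote A τ η)) (rules X)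
  eval-rhs τ u X with owner X
  ... | prover  = trans (eval-⋀ u (sem G A τ) (rules X) (hasRule X))
                        (quantifier-cong prover (rules X) (cong (eval u) ∘ sem≡denote τ))
  ... | refuter = trans (eval-⋁ u (sem G A τ) (rules X))
                        (quantifier-cong refuter (rules X) (cong (eval u) ∘ sem≡denote τ))

  eval-rhs-in-context : ∀ τ v w X γ → eval (context A τ w γ v) (rhs G A τ X) ≡
                        quantifier (owner X) (λ η → eval v (denote A τ (word w ++ η ++ γ))) (rules X)
  eval-rhs-in-context τ v w X γ = trans (eval-rhs τ _ X)
    (quantifier-cong (owner X) (rules X) (λ η → sym (eval-at-replacement A τ v w η γ)))

  rhs-mono : ∀ {τ τ'} → (∀ X → τ X ⇒F τ' X) → ∀ X → rhs G A τ X ⇒F rhs G A τ' X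
  rhs-mono {τ} {τ'} τ⇒τ' X v e = subst (_≡ true) (sym (eval-rhs τ' v X))
    (quantifier-mono (owner X) (rules X) (λ {η} _ → denote-mono A τ⇒τ' η v) (subst (_≡ true) (eval-rhs τ v X) e))

  solution-unfolds : ∀ {τ} → IsSolution G A τ → ∀ v w X γ →
                     eval v (denote A τ (word w ++ inj₁ X ∷ γ)) ≡
                     quantifier (owner X) (λ η → eval v (denote A τ (word w ++ η ++ γ))) (rules X)
  solution-unfolds {τ} solution v w X γ = begin
    eval v (denote A τ (word w ++ inj₁ X ∷ γ)) ≡⟨ eval-at-nonterminal A τ v w X γ ⟩
    eval u (τ X)                               ≡⟨ ≡true-ext (proj₁ (solution X) u) (proj₂ (solution X) u) ⟩
    eval u (rhs G A τ X)                       ≡⟨ eval-rhs-in-context τ v w X γ ⟩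
    quantifier (owner X) (λ η → eval v (denote A τ (word w ++ η ++ γ))) (rules X) ∎
    where
    open ≡-Reasoning
    u = context A τ w γ v

  kleene : ℕ → Fin n → Formula k
  kleene zero    _ = ff
  kleene (suc j) = rhs G A (kleene j)

  kleene-ascending : ∀ j X → kleene j X ⇒F kleene (suc j) X
  kleene-ascending zero    X v ()
  kleene-ascending (suc j) = rhs-mono (kleene-ascending j)

  -- The chain is observed on the finitely many valuations, where it must become stationary.
  kleene-converges : ∃ λ m → IsSolution G A (kleene m)
  kleene-converges with m , stationary ← ascending-stationary (λ j (X , u) → eval u (kleene j X))
                                           (λ j {(X , u)} → kleene-ascending j X u)
                                           (cartesianProduct (allFin n) valuations) =
    m , λ X → kleene-ascending m X , descends X
    where
    descends : ∀ X → kleene (suc m) X ⇒F kleene m X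
    descends X v e with u , u∈ , u≗v ← valuations-complete v =
      trans (eval-cong (sym ∘ u≗v) (kleene m X))
        (stationary (∈-cartesianProduct⁺ (∈-allFin X) u∈) (trans (eval-cong u≗v (kleene (suc m) X)) e))

-- Plays and strategies

module _ {n t : ℕ} (G : Grammar n t) where
  open Grammar G

  leftmost-word : ∀ w → leftmost G (word w) ≡ nothing
  leftmost-word [] = refl
  leftmost-word (a ∷ w) = leftmost-word w

  leftmost-nonterminal : ∀ w X γ → leftmost G (word w ++ inj₁ X ∷ γ) ≡ just X
  leftmost-nonterminal [] X γ = refl
  leftmost-nonterminal (a ∷ w) X γ = leftmost-nonterminal w X γ

  greedyMove : (SF G → Bool) → ∀ {α X} → View α → leftmost G α ≡ just X → Σ (SF G) (Step G α)
  greedyMove good (terminal w) e with () ← trans (sym (leftmost-word w)) e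
  greedyMove good (nonterminal w X γ) _ =
    let η , η∈ , _ = choose (λ η → good (word w ++ η ++ γ)) (rules X) (hasRule X)
    in word w ++ η ++ γ , derive w X η γ η∈

  -- good h β judges the position β reached after the history h
  greedy : ∀ {p} → (List (SF G) → SF G → Bool) → Strategy G p
  greedy good h α X e _ = greedyMove (good (α ∷ h)) (view α) e

  greedy-good : ∀ {p} good {h w X γ η} → owner X ≡ p →
                Conforms G (greedy {p} good) h (word w ++ inj₁ X ∷ γ) (word w ++ η ++ γ) →
                any (λ η → good ((word w ++ inj₁ X ∷ γ) ∷ h) (word w ++ η ++ γ)) (rules X) ≡ true →
                good ((word w ++ inj₁ X ∷ γ) ∷ h) (word w ++ η ++ γ) ≡ true
  greedy-good good {h} {w} {X} {γ} o conforms some-good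
    rewrite conforms X (leftmost-nonterminal w X γ) o | view-nonterminal w X γ =
    proj₂ (proj₂ (choose (λ η → good ((word w ++ inj₁ X ∷ γ) ∷ h) (word w ++ η ++ γ)) (rules X) (hasRule X))) some-good

  origin : List (SF G) → SF G → SF G
  origin [] α = α
  origin (β ∷ h) _ = origin h β

  origin-history : ∀ π i → origin (history G π i) (π i) ≡ π 0
  origin-history π zero = refl
  origin-history π (suc i) = origin-history π i

  length-history : ∀ π i → length (history G π i) ≡ i
  length-history π zero = refl
  length-history π (suc i) = cong suc (length-history π i)

  Reach-history : ∀ {p} {s : Strategy G p} {π} →
                  (∀ i → Step G (π i) (π (suc i)) × Conforms G s (history G π i) (π i) (π (suc i))) →
                  ∀ i → Reach G s (π 0) (history G π i) (π i)
  Reach-history steps zero = start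
  Reach-history steps (suc i) = move (Reach-history steps i) (proj₁ (steps i)) (proj₂ (steps i))

  mover-conforms : ∀ {p} (s : Strategy G p) h α X (e : leftmost G α ≡ just X) (o : owner X ≡ p) →
                   Conforms G s h α (proj₁ (s h α X e o))
  mover-conforms s h α X e o X′ e′ o′ with refl ← trans (sym e) e′ rewrite uip e e′ | uip o o′ = refl

  idle-conforms : ∀ {p p′} (s : Strategy G p) h {α β X} → leftmost G α ≡ just X → owner X ≡ p′ → p′ ≢ p →
                  Conforms G s h α β
  idle-conforms s h e o p′≢p X′ e′ o′ with refl ← trans (sym e) e′ = ⊥-elim (p′≢p (trans (sym o) o′))

  last-move : ∀ {p} {s : Strategy G p} {p₀ h α β} → Reach G s p₀ (α ∷ h) β → Step G α β × Conforms G s h α β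
  last-move (move _ α⇒β conforms) = α⇒β , conforms

-- Prover

module _ {n t k : ℕ} (G : Grammar n t) (A : NFA k t) where
  open Grammar G

  module _ {τ : Fin n → Formula k} (solution : IsSolution G A τ) where

    private
      rejects : SF G → Bool
      rejects α = eval (ν A) (denote A τ α)

    keepAccepting : Strategy G prover
    keepAccepting = greedy G (λ _ β → not (rejects β))

    keepAccepting-invariant : ∀ {p₀ h α} → rejects p₀ ≡ false → Reach G keepAccepting p₀ h α → rejects α ≡ false
    keepAccepting-invariant r₀ start = r₀
    keepAccepting-invariant r₀ (move {h} r (derive w X η γ η∈) conforms) = by-owner (owner X) refl
      where
      unfolded : quantifier (owner X) (λ η → rejects (word w ++ η ++ γ)) (rules X) ≡ false
      unfolded = trans (sym (solution-unfolds G A solution (ν A) w X γ)) (keepAccepting-invariant r₀ r)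
      by-owner : ∀ p → owner X ≡ p → rejects (word w ++ η ++ γ) ≡ false
      by-owner prover o with η′ , η′∈ , r′ ← all-false _ (rules X) (subst (λ p → quantifier p _ _ ≡ false) o unfolded) =
        not-injective {y = false}
          (greedy-good G (λ _ β → not (rejects β)) {h} {w} {X} {γ} {η} o conforms (any-intro _ η′∈ (cong not r′)))
      by-owner refuter o = any-false _ (subst (λ p → quantifier p _ _ ≡ false) o unfolded) η∈

    nonrejecting⇒ProverRegion : ∀ {p₀} → rejects p₀ ≡ false → ProverRegion G A p₀
    nonrejecting⇒ProverRegion r₀ = keepAccepting , λ h w r →
      ¬ν⇒Accepts A w (trans (cong (eval (ν A)) (sym (denote-word A τ w))) (keepAccepting-invariant r₀ r))

  -- Refuter

  mutual
    refuterForces : ℕ → SF G → Bool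
    refuterForces i α = forcesView i (view α)

    forcesView : ℕ → ∀ {α} → View α → Bool
    forcesView _       (terminal w)        = ν A (wordBox A w)
    forcesView zero    (nonterminal _ _ _) = false
    forcesView (suc i) (nonterminal w X γ) =
      quantifier (owner X) (λ η → refuterForces i (word w ++ η ++ γ)) (rules X)

  refuterForces-word : ∀ i w → refuterForces i (word w) ≡ ν A (wordBox A w)
  refuterForces-word i w = cong (forcesView i) (view-word w)

  refuterForces-step : ∀ i w X γ → refuterForces i (word w ++ inj₁ X ∷ γ) ≡ true →
                       quantifier (owner X) (λ η → refuterForces (pred i) (word w ++ η ++ γ)) (rules X) ≡ true
  refuterForces-step i w X γ e with trans (sym (cong (forcesView i) (view-nonterminal w X γ))) e
  refuterForces-step zero    w X γ e | ()
  refuterForces-step (suc i) w X γ e | f = f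

  refuterForces-unfold : ∀ i w X γ →
                         quantifier (owner X) (λ η → refuterForces i (word w ++ η ++ γ)) (rules X) ≡ true →
                         refuterForces (suc i) (word w ++ inj₁ X ∷ γ) ≡ true
  refuterForces-unfold i w X γ = trans (cong (forcesView (suc i)) (view-nonterminal w X γ))

  -- every non-terminal occurrence carries the Kleene stage at which it is evaluated
  Annotated : Set
  Annotated = List ((Fin n × ℕ) ⊎ Fin t)

  stage : Fin n × ℕ → Formula k
  stage (X , j) = kleene G A j X

  annotate : ℕ → SF G → Annotated
  annotate j = map (map₁ (_, j))

  erase : Annotated → SF G
  erase = map (map₁ proj₁)

  erase-annotate : ∀ j α → erase (annotate j α) ≡ α
  erase-annotate j [] = refl
  erase-annotate j (inj₁ X ∷ α) = cong (inj₁ X ∷_) (erase-annotate j α)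
  erase-annotate j (inj₂ a ∷ α) = cong (inj₂ a ∷_) (erase-annotate j α)

  erase-word++ : ∀ w r → erase (word w ++ r) ≡ word w ++ erase r
  erase-word++ [] r = refl
  erase-word++ (a ∷ w) r = cong (inj₂ a ∷_) (erase-word++ w r)

  denote-annotate : ∀ j α → denote A stage (annotate j α) ≡ denote A (kleene G A j) α
  denote-annotate j [] = refl
  denote-annotate j (inj₁ X ∷ α) = cong (kleene G A j X ⨾_) (denote-annotate j α)
  denote-annotate j (inj₂ a ∷ α) = cong (atom (letterBox A a) ⨾_) (denote-annotate j α)

  stage-unfolds : ∀ v w X j γ →
                  eval v (denote A stage (word w ++ inj₁ (X , suc j) ∷ γ)) ≡
                  quantifier (owner X) (λ η → eval v (denote A stage (word w ++ annotate j η ++ γ))) (rules X)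
  stage-unfolds v w X j γ = trans (eval-at-nonterminal A stage v w (X , suc j) γ)
    (trans (eval-rhs G A (kleene G A j) _ X)
      (quantifier-cong (owner X) (rules X) λ η →
        trans (cong (eval _) (sym (denote-annotate j η))) (sym (eval-at-replacement A stage v w (annotate j η) γ))))

  ruleMass : ℕ
  ruleMass = sum (map (λ X → sum (map length (rules X))) (allFin n))

  length≤ruleMass : ∀ {X η} → η ∈ rules X → length η ≤ ruleMass
  length≤ruleMass {X} η∈ = ≤-trans (≤-sum-map length η∈) (≤-sum-map (λ X → sum (map length (rules X))) (∈-allFin X))

  -- The base exceeds every rule length, so an occurrence at stage j + 1 outweighs a whole
  -- right-hand side at stage j.
  weight : Annotated → ℕ
  weight = sum ∘ map symbolWeight
    where
    symbolWeight : (Fin n × ℕ) ⊎ Fin t → ℕ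
    symbolWeight (inj₁ (_ , j)) = suc ruleMass ^ j
    symbolWeight (inj₂ _)       = 0

  weight-++ : ∀ r s → weight (r ++ s) ≡ weight r + weight s
  weight-++ r s = trans (cong sum (map-++ _ r s)) (sum-++ (map _ r) _)

  weight-word++ : ∀ w r → weight (word w ++ r) ≡ weight r
  weight-word++ [] r = refl
  weight-word++ (a ∷ w) r = weight-word++ w r

  weight-annotate : ∀ j η → weight (annotate j η) ≤ length η * suc ruleMass ^ j
  weight-annotate j [] = z≤n
  weight-annotate j (inj₁ X ∷ η) = +-monoʳ-≤ (suc ruleMass ^ j) (weight-annotate j η)
  weight-annotate j (inj₂ a ∷ η) = ≤-trans (weight-annotate j η) (m≤n+m _ (suc ruleMass ^ j))

  unfolding-lighter : ∀ {X η} j → η ∈ rules X → weight (annotate j η) < suc ruleMass ^ suc j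
  unfolding-lighter {η = η} j η∈ = ≤-<-trans (≤-trans (weight-annotate j η) (*-monoˡ-≤ _ (length≤ruleMass η∈)))
                                     (m<n+m _ (m^n>0 (suc ruleMass) j))

  mutual
    rejecting⇒refuterForces : ∀ i r → weight r ≤ i → eval (ν A) (denote A stage r) ≡ true →
                              refuterForces i (erase r) ≡ true
    rejecting⇒refuterForces i r = byView i (view r)

    private
      byView : ∀ i {r} → View r → weight r ≤ i → eval (ν A) (denote A stage r) ≡ true →
               refuterForces i (erase r) ≡ true
      byView i (terminal w) _ e =
        subst (λ α → refuterForces i α ≡ true) (map-∘ w)
          (trans (refuterForces-word i w) (trans (cong (eval (ν A)) (sym (denote-word A stage w))) e))
      byView i (nonterminal w (X , zero) γ) _ e with () ← trans (sym (eval-at-nonterminal A stage (ν A) w (X , zero) γ)) e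
      byView zero (nonterminal w (X , suc j) γ) le _
        with () ← ≤-trans (m^n>0 (suc ruleMass) (suc j)) (≤-trans (m≤m+n _ _) (subst (_≤ 0) (weight-word++ w _) le))
      byView (suc i) (nonterminal w (X , suc j) γ) le e =
        subst (λ α → refuterForces (suc i) α ≡ true) (sym (erase-word++ w (inj₁ (X , suc j) ∷ γ)))
          (refuterForces-unfold i w X (erase γ)
            (quantifier-mono (owner X) (rules X) unfold (trans (sym (stage-unfolds (ν A) w X j γ)) e)))
        where
        unfold : ∀ {η} → η ∈ rules X → eval (ν A) (denote A stage (word w ++ annotate j η ++ γ)) ≡ true →
                 refuterForces i (word w ++ η ++ erase γ) ≡ true
        unfold {η} η∈ e′ = subst (λ α → refuterForces i α ≡ true) erased
                             (rejecting⇒refuterForces i (word w ++ annotate j η ++ γ) lighter e′)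
          where
          erased : erase (word w ++ annotate j η ++ γ) ≡ word w ++ η ++ erase γ
          erased = trans (erase-word++ w _)
                     (cong (word w ++_) (trans (map-++ _ (annotate j η) γ) (cong (_++ erase γ) (erase-annotate j η))))
          lighter : weight (word w ++ annotate j η ++ γ) ≤ i
          lighter = m<1+n⇒m≤n (begin-strict
            weight (word w ++ annotate j η ++ γ)   ≡⟨ weight-word++ w _ ⟩
            weight (annotate j η ++ γ)              ≡⟨ weight-++ (annotate j η) γ ⟩
            weight (annotate j η) + weight γ        <⟨ +-monoˡ-< (weight γ) (unfolding-lighter j η∈) ⟩
            suc ruleMass ^ suc j + weight γ         ≡⟨ weight-word++ w _ ⟨
            weight (word w ++ inj₁ (X , suc j) ∷ γ) ≤⟨ le ⟩
            suc i                                   ∎)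
            where open ≤-Reasoning

  Step⇒¬refuterForces-zero : ∀ {α β} → Step G α β → refuterForces 0 α ≡ false
  Step⇒¬refuterForces-zero (derive w X η γ _) = cong (forcesView 0) (view-nonterminal w X γ)

  module _ (j : ℕ) where

    private
      rejects : SF G → Bool
      rejects α = eval (ν A) (denote A (kleene G A j) α)

      budget : SF G → ℕ
      budget α = weight (annotate j α)

    -- the budget counts down from the weight of the starting position
    forceRejection : Strategy G refuter
    forceRejection = greedy G (λ h β → refuterForces (budget (origin G h β) ∸ length h) β)

    forceRejection-invariant : ∀ {p₀ h α} → rejects p₀ ≡ true → Reach G forceRejection p₀ h α →
                               refuterForces (budget (origin G h α) ∸ length h) α ≡ true
    forceRejection-invariant {p₀} r₀ start =
      subst (λ α → refuterForces (budget p₀) α ≡ true) (erase-annotate j p₀)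
        (rejecting⇒refuterForces (budget p₀) (annotate j p₀) ≤-refl
          (trans (cong (eval (ν A)) (denote-annotate j p₀)) r₀))
    forceRejection-invariant r₀ (move {h} {α} r (derive w X η γ η∈) conforms) = by-owner (owner X) refl
      where
      reaches : ℕ → List (Fin n ⊎ Fin t) → Bool
      reaches c η = refuterForces c (word w ++ η ++ γ)
      c = budget (origin G h α) ∸ suc (length h)
      next : quantifier (owner X) (reaches c) (rules X) ≡ true
      next = subst (λ c → quantifier (owner X) (reaches c) (rules X) ≡ true) (pred[m∸n]≡m∸[1+n] _ (length h))
               (refuterForces-step _ w X γ (forceRejection-invariant r₀ r))
      by-owner : ∀ p → owner X ≡ p → reaches c η ≡ true
      by-owner prover  o = all-true (reaches c) (subst (λ p → quantifier p (reaches c) (rules X) ≡ true) o next) η∈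
      by-owner refuter o = greedy-good G (λ h β → refuterForces (budget (origin G h β) ∸ length h) β) {h} {w} {X} {γ} {η}
                             o conforms (subst (λ p → quantifier p (reaches c) (rules X) ≡ true) o next)

    rejecting⇒RefuterRegion : ∀ {p₀} → rejects p₀ ≡ true → RefuterRegion G A p₀
    rejecting⇒RefuterRegion r₀ = forceRejection , no-infinite-play , λ h w r →
      ν⇒¬Accepts A w (trans (sym (refuterForces-word _ w)) (forceRejection-invariant r₀ r))
      where
      no-infinite-play : ¬ InfinitePlay G forceRejection _
      no-infinite-play (π , refl , steps) = contradiction exhausted (λ e →
        case trans (sym e) (Step⇒¬refuterForces-zero (proj₁ (steps b))) of λ ())
        where
        b = budget (π 0)
        exhausted : refuterForces 0 (π b) ≡ true
        exhausted = subst (λ c → refuterForces c (π b) ≡ true)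
          (trans (cong₂ (λ p l → budget p ∸ l) (origin-history G π b) (length-history G π b)) (n∸n≡0 b))
          (forceRejection-invariant r₀ (Reach-history G steps b))

  -- σ lies below the Kleene limit, so rejection under σ entails rejection at a finite stage.
  leastSolution-rejecting⇒RefuterRegion : ∀ {σ} → IsLeastSolution G A σ → ∀ {p₀} →
                                          eval (ν A) (denote A σ p₀) ≡ true → RefuterRegion G A p₀
  leastSolution-rejecting⇒RefuterRegion (_ , least) {p₀} r₀ with m , converged ← kleene-converges G A =
    rejecting⇒RefuterRegion m (denote-mono A (least (kleene G A m) converged) p₀ (ν A) r₀)

-- Determinacy

module _ {n t k : ℕ} (G : Grammar n t) (A : NFA k t) where
  open Grammar G

  -- Following both strategies never reaches a terminal word, which would be accepted and
  -- rejected at once; so it yields an infinite play conforming to refuter's strategy.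
  ¬ProverRegion×RefuterRegion : ∀ {p₀} → ProverRegion G A p₀ → RefuterRegion G A p₀ → ⊥
  ¬ProverRegion×RefuterRegion {p₀} (sp , prover-wins) (sr , finite , refuter-wins) =
    finite (position , refl , λ i → subst (λ h → Step G (position i) (position (suc i)) ×
                                                Conforms G sr h (position i) (position (suc i)))
                                           (sym (history-play i)) (last-move G (proj₂ (proj₂ (play (suc i))))))
    where
    Both : List (SF G) → SF G → Set
    Both h α = Reach G sp p₀ h α × Reach G sr p₀ h α

    nextView : ∀ {h α} → View α → Both h α → Σ (SF G) (Both (α ∷ h))
    nextView {h} (terminal w) (rp , rr) = ⊥-elim (refuter-wins h w rr (prover-wins h w rp))
    nextView {h} (nonterminal w X γ) (rp , rr) = by-owner (owner X) refl
      where
      α = word w ++ inj₁ X ∷ γ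
      e = leftmost-nonterminal G w X γ
      by-owner : ∀ p → owner X ≡ p → Σ (SF G) (Both (α ∷ h))
      by-owner prover o = let β , α⇒β = sp h α X e o in
        β , move rp α⇒β (mover-conforms G sp h α X e o) , move rr α⇒β (idle-conforms G sr h e o λ ())
      by-owner refuter o = let β , α⇒β = sr h α X e o in
        β , move rp α⇒β (idle-conforms G sp h e o λ ()) , move rr α⇒β (mover-conforms G sr h α X e o)

    play : ℕ → Σ (List (SF G) × SF G) λ (h , α) → Both h α
    play zero = ([] , p₀) , start , start
    play (suc i) = let (h , α) , both = play i ; β , both′ = nextView (view α) both in (α ∷ h , β) , both′

    position : ℕ → SF G
    position i = proj₂ (proj₁ (play i))

    history-play : ∀ i → history G position i ≡ proj₁ (proj₁ (play i))
    history-play zero = refl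
    history-play (suc i) = cong (position i ∷_) (history-play i)

theorem16 : ∀ {n t k} (G : Grammar n t) (A : NFA k t) (σ : Fin n → Formula k) →
            IsLeastSolution G A σ →
            (∀ (α : SF G) →
               ((¬ Rejecting A (sem G A σ α)) ⇔ ProverRegion G A α) ×
               (Rejecting A (sem G A σ α) ⇔ RefuterRegion G A α)) ×
            (∀ (α : SF G) → ProverRegion G A α ⊎ RefuterRegion G A α)
theorem16 G A σ least@(solution , _) =
  (λ α → mk⇔ (proverWins α) (λ win r → disjoint win (refuterWins α r)) , mk⇔ (refuterWins α) (refuter⇒rejecting α)) ,
  determined
  where
  disjoint : ∀ {α} → ProverRegion G A α → RefuterRegion G A α → ⊥
  disjoint = ¬ProverRegion×RefuterRegion G A

  sem-denote : ∀ α → eval (ν A) (sem G A σ α) ≡ eval (ν A) (denote A σ α)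
  sem-denote α = cong (eval (ν A)) (sem≡denote G A σ α)

  proverWins : ∀ α → ¬ Rejecting A (sem G A σ α) → ProverRegion G A α
  proverWins α nr = nonrejecting⇒ProverRegion G A solution (trans (sym (sem-denote α)) (¬-not nr))

  refuterWins : ∀ α → Rejecting A (sem G A σ α) → RefuterRegion G A α
  refuterWins α r = leastSolution-rejecting⇒RefuterRegion G A least (trans (sym (sem-denote α)) r)

  refuter⇒rejecting : ∀ α → RefuterRegion G A α → Rejecting A (sem G A σ α)
  refuter⇒rejecting α win with eval (ν A) (sem G A σ α) ≟ true
  ... | yes r  = r
  ... | no  nr = ⊥-elim (disjoint (proverWins α nr) win)

  determined : ∀ α → ProverRegion G A α ⊎ RefuterRegion G A α
  determined α with eval (ν A) (sem G A σ α) ≟ true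
  ... | yes r  = inj₂ (refuterWins α r)
  ... | no  nr = inj₁ (proverWins α nr)
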